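{- For the elementary cellular automaton $F_{76}$, $D(\textsc{Pred}_{F_{76},n})\in O(1)$.
   Context: The ECA with Wolfram number $N$ is $F_N:\{0,1\}^{\mathbb{Z}}\to\{0,1\}^{\mathbb{Z}}$, $(F_N(x))_i=f_N(x_{i-1},x_i,x_{i+1})$, where $f_N(a,b,c)$ is the bit of index $4a+2b+c$ of $N$ in binary. On a finite word of length $m$, $F_N$ returns the word of length $m-2$ obtained by applying $f_N$ wherever it is defined. $\textsc{Pred}_{F,n}:\{0,1\}^{2n+1}\to\{0,1\}$ maps $x$ to the unique cell of $F^n(x)$. For finite sets $X,Y,Z$ and $g:X\times Y\to Z$, $D(g)$ is the minimal depth of a deterministic two-party communication protocol tree computing $g$ (Alice knows $x$, Bob knows $y$; internal nodes are labelled by a function of $x$ alone or of $y$ alone to $\{\mathrm{l},\mathrm{r}\}$ selecting the child, leaves are labelled by outputs). For $g:\{0,1\}^m\to Z$, $D(g)=\max_{0\le i\le m} D(g_i)$ where $g_i:\{0,1\}^i\times\{0,1\}^{m-i}\to Z$, $g_i(x,y)=g(xy)$. -}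

module Defs where

open import Data.Bool using (Bool; true; false; if_then_else_)
open import Data.Nat using (ℕ; zero; suc; _+_; _*_; _^_; _≤_; _≡ᵇ_)
open import Data.Nat.DivMod using (_/_; _%_)
open import Data.Vec using (Vec; []; _∷_; head; _++_; cast)
open import Data.Product using (∃; ∃-syntax; _×_; _,_)
open import Relation.Binary.PropositionalEquality using (_≡_)

bitVal : Bool → ℕ
bitVal false = 0
bitVal true  = 1

bitOf : ℕ → ℕ → Bool
bitOf N zero    = (N % 2) ≡ᵇ 1
bitOf N (suc k) = bitOf (N / 2) k

localRule : ℕ → Bool → Bool → Bool → Bool
localRule N a b c = bitOf N (4 * bitVal a + 2 * bitVal b + bitVal c)

step : (N : ℕ) {m : ℕ} → Vec Bool (suc (suc m)) → Vec Bool m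
step N {zero}  (a ∷ b ∷ []) = []
step N {suc m} (a ∷ b ∷ c ∷ w) = localRule N a b c ∷ step N (b ∷ c ∷ w)

iter : (N : ℕ) (n : ℕ) {m : ℕ} → Vec Bool (n * 2 + m) → Vec Bool m
iter N zero    w = w
iter N (suc n) w = iter N n (step N w)

Pred : (N : ℕ) (n : ℕ) → Vec Bool (n * 2 + 1) → Bool
Pred N n x = head (iter N n x)

-- deterministic two-party protocol trees (Alice knows x ∈ X, Bob knows y ∈ Y);
-- false = l (left child), true = r (right child)
data Protocol (X Y Z : Set) : Set where
  leaf  : Z → Protocol X Y Z
  alice : (X → Bool) → Protocol X Y Z → Protocol X Y Z → Protocol X Y Z
  bob   : (Y → Bool) → Protocol X Y Z → Protocol X Y Z → Protocol X Y Z

run : {X Y Z : Set} → Protocol X Y Z → X → Y → Z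
run (leaf z)      x y = z
run (alice f l r) x y = if f x then run r x y else run l x y
run (bob g l r)   x y = if g y then run r x y else run l x y

depth : {X Y Z : Set} → Protocol X Y Z → ℕ
depth (leaf z)      = 0
depth (alice f l r) = suc (depth l Data.Nat.⊔ depth r)
depth (bob g l r)   = suc (depth l Data.Nat.⊔ depth r)

-- D(g) ≤ k  (D(g) is the minimal depth of a protocol computing g)
D≤ : {X Y Z : Set} → (X → Y → Z) → ℕ → Set
D≤ {X} {Y} {Z} g k =
  ∃[ P ] (depth P ≤ k × (∀ (x : X) (y : Y) → run P x y ≡ g x y))

split : {Z : Set} {m : ℕ} (i j : ℕ) → i + j ≡ m →
        (Vec Bool m → Z) → Vec Bool i → Vec Bool j → Z
split i j e g x y = g (cast e (x ++ y))

-- D(g) = max_i D(g_i) ≤ k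
Dfun≤ : {Z : Set} {m : ℕ} → (Vec Bool m → Z) → ℕ → Set
Dfun≤ {Z} {m} g k = ∀ (i j : ℕ) (e : i + j ≡ m) → D≤ (split i j e g) k

-- Rule 76 is f(a,b,c) = b ∧ ¬(a ∧ c), and F₇₆ ∘ F₇₆ = F₇₆ already on five-cell
-- windows. Hence Fⁿ⁺¹ = F, so Pred_{F₇₆,n+1} only reads the three central
-- cells of its input, and a protocol that asks for these three bits one at a
-- time (each asked to whichever party holds it) has depth 3 at every split.
module Submission where

open import Defs
open import Data.Nat using (ℕ; _≤_)
open import Data.Product using (∃-syntax)

open import Data.Bool using (Bool; true; false; if_then_else_; not; _∧_)
open import Data.Nat using (zero; suc; pred; _+_; _*_; _∸_; _<_; z≤n; s≤s; _<?_)
open import Data.Nat.Properties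
  using (≮⇒≥; ⊔-lub; m<n⇒m<1+n; +-mono-≤-<; m≤m*n; +-identityʳ)
open import Data.Vec using (Vec; []; _∷_; head; _++_; cast; map)
open import Data.Vec.Properties using (map-cong)
open import Data.Product using (_,_)
open import Function using (_∘_)
open import Relation.Binary.PropositionalEquality
  using (_≡_; refl; sym; trans; cong; module ≡-Reasoning)
open import Relation.Nullary using (yes; no)

-- Reading past the end of a word yields false.
at : ∀ {m} → Vec Bool m → ℕ → Bool
at []      _       = false
at (b ∷ w) zero    = b
at (b ∷ w) (suc k) = at w k

at-cast : ∀ {m n} (e : m ≡ n) (w : Vec Bool m) k → at (cast e w) k ≡ at w k
at-cast {n = zero}  e []      k       = refl
at-cast {n = suc n} e (b ∷ w) zero    = refl
at-cast {n = suc n} e (b ∷ w) (suc k) = at-cast (cong pred e) w k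

at-++ˡ : ∀ {i j} (x : Vec Bool i) (y : Vec Bool j) k → k < i → at (x ++ y) k ≡ at x k
at-++ˡ (b ∷ x) y zero    _       = refl
at-++ˡ (b ∷ x) y (suc k) (s≤s p) = at-++ˡ x y k p

at-++ʳ : ∀ {i j} (x : Vec Bool i) (y : Vec Bool j) k → i ≤ k → at (x ++ y) k ≡ at y (k ∸ i)
at-++ʳ []      y k       _       = refl
at-++ʳ (b ∷ x) y (suc k) (s≤s p) = at-++ʳ x y k p

cell : ℕ → ∀ {m} → Vec Bool m → ℕ → Bool
cell N w k = localRule N (at w k) (at w (suc k)) (at w (suc (suc k)))

IdempotentRule : ℕ → Set
IdempotentRule N = ∀ a b c d e →
  localRule N (localRule N a b c) (localRule N b c d) (localRule N c d e) ≡ localRule N b c d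

at-step : ∀ N {m} (w : Vec Bool (suc (suc m))) k → k < m → at (step N w) k ≡ cell N w k
at-step N {suc m} (a ∷ b ∷ c ∷ w) zero    _       = refl
at-step N {suc m} (a ∷ b ∷ c ∷ w) (suc k) (s≤s p) = at-step N (b ∷ c ∷ w) k p

at-iter-idempotent : ∀ {N} → IdempotentRule N → ∀ n {m} (w : Vec Bool (suc n * 2 + m)) k →
  k < m → at (iter N (suc n) w) k ≡ cell N w (n + k)
at-iter-idempotent {N} idem zero    w k k<m = at-step N w k k<m
at-iter-idempotent {N} idem (suc n) {m} w k k<m = begin
  at (iter N (suc n) (step N w)) k
    ≡⟨ at-iter-idempotent idem n (step N w) k k<m ⟩
  localRule N (at (step N w) i) (at (step N w) (suc i)) (at (step N w) (suc (suc i)))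
    ≡⟨ cong₃ (at-step N w i (m<n⇒m<1+n (m<n⇒m<1+n i<)))
             (at-step N w (suc i) (m<n⇒m<1+n (s≤s i<)))
             (at-step N w (suc (suc i)) (s≤s (s≤s i<))) ⟩
  localRule N (cell N w i) (cell N w (suc i)) (cell N w (suc (suc i)))
    ≡⟨ idem (at w i) (at w (suc i)) (at w (suc (suc i))) (at w (3 + i)) (at w (4 + i)) ⟩
  cell N w (suc i) ∎
  where
  open ≡-Reasoning
  i : ℕ
  i = n + k
  i< : i < n * 2 + m
  i< = +-mono-≤-< (m≤m*n n 2) k<m
  cong₃ : ∀ {a a′ b b′ c c′} → a ≡ a′ → b ≡ b′ → c ≡ c′ → localRule N a b c ≡ localRule N a′ b′ c′
  cong₃ refl refl refl = refl

Pred-idempotent : ∀ {N} → IdempotentRule N → ∀ n (w : Vec Bool (suc n * 2 + 1)) →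
  Pred N (suc n) w ≡ cell N w n
Pred-idempotent {N} idem n w = begin
  head (iter N (suc n) w)    ≡⟨ head-at (iter N (suc n) w) ⟩
  at (iter N (suc n) w) 0    ≡⟨ at-iter-idempotent idem n w 0 (s≤s z≤n) ⟩
  cell N w (n + 0)           ≡⟨ cong (cell N w) (+-identityʳ n) ⟩
  cell N w n                 ∎
  where
  open ≡-Reasoning
  head-at : (v : Vec Bool 1) → head v ≡ at v 0
  head-at (b ∷ []) = refl

localRule76 : ∀ a b c → localRule 76 a b c ≡ b ∧ not (a ∧ c)
localRule76 false false false = refl
localRule76 false false true  = refl
localRule76 false true  false = refl
localRule76 false true  true  = refl
localRule76 true  false false = refl
localRule76 true  false true  = refl
localRule76 true  true  false = refl
localRule76 true  true  true  = refl

rule76-idempotent : IdempotentRule 76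
rule76-idempotent a b c d e
  rewrite localRule76 a b c | localRule76 b c d | localRule76 c d e
        | localRule76 (b ∧ not (a ∧ c)) (c ∧ not (b ∧ d)) (d ∧ not (c ∧ e))
  = lemma a b c d e
  where
  lemma : ∀ a b c d e →
    (c ∧ not (b ∧ d)) ∧ not ((b ∧ not (a ∧ c)) ∧ (d ∧ not (c ∧ e))) ≡ c ∧ not (b ∧ d)
  lemma a     b     false d     e = refl
  lemma a     false true  d     e = refl
  lemma a     true  true  true  e = refl
  lemma false true  true  false e = refl
  lemma true  true  true  false e = refl

query : ∀ {i j} {Z : Set} → ℕ → (l r : Protocol (Vec Bool i) (Vec Bool j) Z) →
  Protocol (Vec Bool i) (Vec Bool j) Z
query {i} p l r with p <? i
... | yes _ = alice (λ x → at x p) l r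
... | no  _ = bob (λ y → at y (p ∸ i)) l r

query-depth : ∀ {i j} {Z : Set} p (l r : Protocol (Vec Bool i) (Vec Bool j) Z) {d} →
  depth l ≤ d → depth r ≤ d → depth (query p l r) ≤ suc d
query-depth {i} p l r hl hr with p <? i
... | yes _ = s≤s (⊔-lub hl hr)
... | no  _ = s≤s (⊔-lub hl hr)

run-query : ∀ {i j} {Z : Set} p (l r : Protocol (Vec Bool i) (Vec Bool j) Z) x y →
  run (query p l r) x y ≡ (if at (x ++ y) p then run r x y else run l x y)
run-query {i} p l r x y with p <? i
... | yes p<i rewrite at-++ˡ x y p p<i     = refl
... | no  p≮i rewrite at-++ʳ x y p (≮⇒≥ p≮i) = refl

junta : ∀ {i j k} {Z : Set} → Vec ℕ k → (Vec Bool k → Z) → Protocol (Vec Bool i) (Vec Bool j) Z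
junta []       h = leaf (h [])
junta (p ∷ ps) h = query p (junta ps (h ∘ (false ∷_))) (junta ps (h ∘ (true ∷_)))

junta-depth : ∀ {i j k} {Z : Set} (ps : Vec ℕ k) (h : Vec Bool k → Z) →
  depth (junta {i} {j} ps h) ≤ k
junta-depth []       h = z≤n
junta-depth {i} {j} (p ∷ ps) h =
  query-depth p _ _ (junta-depth {i} {j} ps _) (junta-depth {i} {j} ps _)

run-junta : ∀ {i j k} {Z : Set} (ps : Vec ℕ k) (h : Vec Bool k → Z) (x : Vec Bool i) (y : Vec Bool j) →
  run (junta ps h) x y ≡ h (map (at (x ++ y)) ps)
run-junta []       h x y = refl
run-junta (p ∷ ps) h x y
  rewrite run-query p (junta ps (h ∘ (false ∷_))) (junta ps (h ∘ (true ∷_))) x y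
  with at (x ++ y) p
... | false = run-junta ps (h ∘ (false ∷_)) x y
... | true  = run-junta ps (h ∘ (true ∷_)) x y

Dfun≤-junta : ∀ {k m} {Z : Set} (g : Vec Bool m → Z) (ps : Vec ℕ k) (h : Vec Bool k → Z) →
  (∀ w → g w ≡ h (map (at w) ps)) → Dfun≤ g k
Dfun≤-junta g ps h g≡h i j e = junta ps h , junta-depth {i} {j} ps h , λ x y →
  trans (run-junta ps h x y)
        (sym (trans (g≡h (cast e (x ++ y))) (cong h (map-cong (at-cast e (x ++ y)) ps))))

proposition2 : ∃[ c ] ∃[ n₀ ] (∀ (n : ℕ) → n₀ ≤ n → Dfun≤ (Pred 76 n) c)
proposition2 = 3 , 1 , λ where
  (suc n) _ → Dfun≤-junta (Pred 76 (suc n)) (n ∷ suc n ∷ suc (suc n) ∷ [])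
                (λ { (a ∷ b ∷ c ∷ []) → localRule 76 a b c })
                (Pred-idempotent rule76-idempotent n)
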